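{- For every positive integer $m$, each of the following three sets is MSTD: $(1|1,1,2,1,\underbrace{4,\dots,4}_{m},3,1,1,2)=\{1,2,3,5,6\}\cup\{6+4j:1\le j\le m\}\cup\{9+4m,10+4m,11+4m,13+4m\}$, $(1|1,1,2,1,\underbrace{4,\dots,4}_{m},3,1,1,2,1)=\{1,2,3,5,6\}\cup\{6+4j:1\le j\le m\}\cup\{9+4m,10+4m,11+4m,13+4m,14+4m\}$, $(1|1,1,2,1,\underbrace{4,\dots,4}_{m},3,1,1)=\{1,2,3,5,6\}\cup\{6+4j:1\le j\le m\}\cup\{9+4m,10+4m,11+4m\}$.
   Context: Notation: for integers $a_1$ and positive integers $d_1,\dots,d_{t}$, $(a_1|d_1,d_2,\dots,d_t)$ denotes the set $\{a_1,\ a_1+d_1,\ a_1+d_1+d_2,\ \dots,\ a_1+d_1+\dots+d_t\}$ (the elements in increasing order, with consecutive differences $d_1,\dots,d_t$). For a set $A$ of integers, $A+A=\{x+y:x,y\in A\}$, $A-A=\{x-y:x,y\in A\}$. A finite set $A$ is MSTD if $|A+A|>|A-A|$. -}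

module Defs where

open import Data.Nat using (ℕ; suc; _<_; _*_)
open import Data.Integer as ℤ using (ℤ)
open import Data.List using (List; []; _∷_; _++_; length; deduplicate; replicate; concatMap; map)
open import Data.Product using (_×_; _,_)

-- (a | d₁, …, d_t) = {a, a+d₁, a+d₁+d₂, …}, as a list in increasing order
progression : ℤ → List ℤ → List ℤ
progression a []       = a ∷ []
progression a (d ∷ ds) = a ∷ progression (a ℤ.+ d) ds

-- finite sets of integers represented by lists; cardinality counts distinct elements
card : List ℤ → ℕ
card xs = length (deduplicate ℤ._≟_ xs)

sumset : List ℤ → List ℤ
sumset A = concatMap (λ x → map (λ y → x ℤ.+ y) A) A

diffset : List ℤ → List ℤ
diffset A = concatMap (λ x → map (λ y → x ℤ.- y) A) A

MSTD : List ℤ → Set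
MSTD A = card (diffset A) < card (sumset A)

fours : ℕ → List ℤ
fours m = replicate m (ℤ.+ 4)

A₁ A₂ A₃ : ℕ → List ℤ
A₁ m = progression (ℤ.+ 1) ((ℤ.+ 1 ∷ ℤ.+ 1 ∷ ℤ.+ 2 ∷ ℤ.+ 1 ∷ []) ++ fours m ++ (ℤ.+ 3 ∷ ℤ.+ 1 ∷ ℤ.+ 1 ∷ ℤ.+ 2 ∷ []))
A₂ m = progression (ℤ.+ 1) ((ℤ.+ 1 ∷ ℤ.+ 1 ∷ ℤ.+ 2 ∷ ℤ.+ 1 ∷ []) ++ fours m ++ (ℤ.+ 3 ∷ ℤ.+ 1 ∷ ℤ.+ 1 ∷ ℤ.+ 2 ∷ ℤ.+ 1 ∷ []))
A₃ m = progression (ℤ.+ 1) ((ℤ.+ 1 ∷ ℤ.+ 1 ∷ ℤ.+ 2 ∷ ℤ.+ 1 ∷ []) ++ fours m ++ (ℤ.+ 3 ∷ ℤ.+ 1 ∷ ℤ.+ 1 ∷ []))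

module Submission where

open import Defs
open import Data.Bool using (true; false)
open import Data.Integer as ℤ using (ℤ)
import Data.Integer.Properties as ℤ
open import Data.List
  using (List; []; _∷_; _++_; length; map; replicate; upTo; filter; deduplicate; cartesianProductWith)
open import Data.List.Properties
  using (length-removeAt′; length-map; length-++; map-++; map-replicate; length-upTo; upTo-∷ʳ)
open import Data.List.Membership.Propositional using (_∈_; find; lose)
open import Data.List.Membership.Propositional.Properties
  using (∈-map⁺; ∈-map⁻; ∈-++⁺ˡ; ∈-++⁺ʳ; ∈-++⁻; ∈-concatMap⁺; ∈-concatMap⁻; ∈-deduplicate⁺;
         ∈-deduplicate⁻; ∈-cartesianProductWith⁺; ∈-cartesianProductWith⁻; ∈-upTo⁺; ∈-filter⁻)
open import Data.List.Relation.Binary.Subset.Propositional using (_⊆_)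
open import Data.List.Relation.Unary.Any using (here; there; _─_)
open import Data.List.Relation.Unary.All as All using (All; []; _∷_; all?)
open import Data.List.Relation.Unary.Unique.Propositional using (Unique; []; _∷_)
import Data.List.Relation.Unary.Unique.Propositional.Properties as Unique
open import Data.List.Relation.Unary.Unique.DecPropositional.Properties using (deduplicate-!)
open import Data.Nat using (ℕ; zero; suc; _+_; _*_; _∸_; _≤_; _<_; z≤n; s≤s; z<s; s<s)
open import Data.Nat.Properties
open import Data.Nat.DivMod using (_%_; _/_; m≡m%n+[m/n]*n; m%n<n)
open import Data.Nat.ListAction using (sum)
open import Data.Nat.Tactic.RingSolver using (solve-∀)
open import Data.List.Membership.DecPropositional _≟_ using (_∈?_)
open import Data.Product using (_×_; _,_; proj₂; ∃-syntax)
open import Data.Sum using (_⊎_; inj₁; inj₂; [_,_]′)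
open import Relation.Binary.PropositionalEquality
open import Relation.Nullary using (contradiction; yes; no; Dec; does)
open import Relation.Nullary.Decidable using (_×-dec_; _⊎-dec_; ¬?; from-yes)
open import Relation.Unary using (Decidable)

-- Such a set B consists of 1, 2, 3, 5, the progression 6, 10, …, N = 6 + 4m, and a tail
-- N + r, where r runs over the partial sums of the tail gaps (of total length R).
-- Upper bound: sorting a pair of members by kind shows that every non-negative difference is
-- < N + R, and is either < 3, or ≢ 2 (mod 4), or ≥ 4m + 3.  These numbers form the list
-- 0 ∷ posDiffs, so |B - B| ≤ 2 |posDiffs| + 1 = 11 + 6m + 2R (`family-diffs`).
-- Lower bound: B + B contains an explicit strictly increasing list `sumWitness`: 2, …, 10,
-- two runs of `blocks` (three numbers out of every four), and the sums near N and 2N that are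
-- found by a finite search; hence |B + B| ≥ 3 + 6m + #mid + #top.
-- Both bounds use only finitely many facts about the tail (`GoodTail`), so `family-mstd`
-- proves MSTD for all m at once, and the theorem checks these facts by evaluation.

∈-─ : {A : Set} {u x : A} {ys : List A} (u∈ys : u ∈ ys) → x ∈ ys → x ≢ u → x ∈ (ys ─ u∈ys)
∈-─ (here refl) (here refl) x≢u = contradiction refl x≢u
∈-─ (here refl) (there x∈ys) _  = x∈ys
∈-─ (there _)   (here x≡y)   _  = here x≡y
∈-─ (there u∈ys) (there x∈ys) x≢u = there (∈-─ u∈ys x∈ys x≢u)

unique-⊆⇒length≤ : {A : Set} {xs ys : List A} → Unique xs → xs ⊆ ys → length xs ≤ length ys
unique-⊆⇒length≤ {xs = []} _ _ = z≤n
unique-⊆⇒length≤ {xs = x ∷ xs} {ys} (x∉xs ∷ uxs) xs⊆ys =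
  subst (suc (length xs) ≤_) (sym (length-removeAt′ ys _))
        (s≤s (unique-⊆⇒length≤ uxs λ y∈xs → ∈-─ x∈ys (xs⊆ys (there y∈xs)) (distinct y∈xs)))
  where
  x∈ys = xs⊆ys (here refl)
  distinct : ∀ {y} → y ∈ xs → y ≢ x
  distinct y∈xs y≡x = All.lookup x∉xs y∈xs (sym y≡x)

card-≥ : {xs ys : List ℤ} → Unique ys → ys ⊆ xs → length ys ≤ card xs
card-≥ uys ys⊆xs = unique-⊆⇒length≤ uys (λ y∈ys → ∈-deduplicate⁺ ℤ._≟_ (ys⊆xs y∈ys))

card-≤ : {xs zs : List ℤ} → xs ⊆ zs → card xs ≤ length zs
card-≤ {xs} xs⊆zs = unique-⊆⇒length≤ (deduplicate-! ℤ._≟_ xs) (λ p → xs⊆zs (∈-deduplicate⁻ ℤ._≟_ xs p))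

∈-sumset⁺ : {A : List ℤ} {x y : ℤ} → x ∈ A → y ∈ A → x ℤ.+ y ∈ sumset A
∈-sumset⁺ {A} x∈A y∈A = ∈-concatMap⁺ (λ x → map (λ y → x ℤ.+ y) A) (lose x∈A (∈-map⁺ _ y∈A))

∈-diffset⁻ : {A : List ℤ} {z : ℤ} → z ∈ diffset A → ∃[ x ] ∃[ y ] x ∈ A × y ∈ A × z ≡ x ℤ.- y
∈-diffset⁻ {A} z∈A-A
  with x , x∈A , z∈x-A ← find (∈-concatMap⁻ (λ x → map (λ y → x ℤ.- y) A) z∈A-A)
  with y , y∈A , z≡x-y ← ∈-map⁻ (λ y → x ℤ.- y) z∈x-A
  = x , y , x∈A , y∈A , z≡x-y

sumsℕ : List ℕ → List ℕ
sumsℕ B = cartesianProductWith _+_ B B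

sum∈ : ∀ {B a b y} → a ∈ B → b ∈ B → a + b ≡ y → y ∈ sumsℕ B
sum∈ a∈B b∈B refl = ∈-cartesianProductWith⁺ _+_ a∈B b∈B

sumsℕ-mono : ∀ {A B} → A ⊆ B → sumsℕ A ⊆ sumsℕ B
sumsℕ-mono {A} A⊆B p with a , b , a∈A , b∈A , refl ← ∈-cartesianProductWith⁻ _+_ A A p =
  sum∈ (A⊆B a∈A) (A⊆B b∈A) refl

sumset-≥ : (B Y : List ℕ) → Unique Y → Y ⊆ sumsℕ B → length Y ≤ card (sumset (map ℤ.+_ B))
sumset-≥ B Y uY Y⊆B+B =
  subst (_≤ card (sumset (map ℤ.+_ B))) (length-map ℤ.+_ Y) (card-≥ (Unique.map⁺ ℤ.+-injective uY) Y⊆)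
  where
  Y⊆ : map ℤ.+_ Y ⊆ sumset (map ℤ.+_ B)
  Y⊆ p with y , y∈Y , refl ← ∈-map⁻ ℤ.+_ p
       with a , b , a∈B , b∈B , refl ← ∈-cartesianProductWith⁻ _+_ B B (Y⊆B+B y∈Y)
       = ∈-sumset⁺ (∈-map⁺ ℤ.+_ a∈B) (∈-map⁺ ℤ.+_ b∈B)

-- Upper bound for |B - B|: if every non-negative difference of B lies in 0 ∷ Q, then
-- B - B ⊆ {0} ∪ Q ∪ -Q, which has at most 2|Q| + 1 members.
diffset-≤ : (B Q : List ℕ) → (∀ {a b} → a ∈ B → b ∈ B → b ≤ a → a ∸ b ∈ 0 ∷ Q) →
            card (diffset (map ℤ.+_ B)) ≤ suc (length Q + length Q)
diffset-≤ B Q diff∈ = subst (card (diffset (map ℤ.+_ B)) ≤_) size (card-≤ B-B⊆)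
  where
  signed : List ℤ
  signed = map ℤ.+_ (0 ∷ Q) ++ map (λ q → ℤ.- (ℤ.+ q)) Q

  size : length signed ≡ suc (length Q + length Q)
  size = trans (length-++ (map ℤ.+_ (0 ∷ Q)))
               (cong₂ (λ m n → suc (m + n)) (length-map ℤ.+_ Q) (length-map (λ q → ℤ.- (ℤ.+ q)) Q))

  ⊖∈signed : ∀ {a b} → a ∈ B → b ∈ B → a ℤ.⊖ b ∈ signed
  ⊖∈signed {a} {b} a∈B b∈B with b ≤? a
  ... | yes b≤a = subst (_∈ signed) (sym (ℤ.⊖-≥ b≤a)) (∈-++⁺ˡ (∈-map⁺ ℤ.+_ (diff∈ a∈B b∈B b≤a)))
  ... | no b≰a with diff∈ b∈B a∈B (≰⇒≥ b≰a)
  ...   | here b∸a≡0  = contradiction b∸a≡0 (m>n⇒m∸n≢0 (≰⇒> b≰a))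
  ...   | there b∸a∈Q = subst (_∈ signed) (sym (ℤ.⊖-≰ b≰a))
                              (∈-++⁺ʳ (map ℤ.+_ (0 ∷ Q)) (∈-map⁺ (λ q → ℤ.- (ℤ.+ q)) b∸a∈Q))

  B-B⊆ : diffset (map ℤ.+_ B) ⊆ signed
  B-B⊆ p with x , y , x∈ , y∈ , refl ← ∈-diffset⁻ {map ℤ.+_ B} p
         with a , a∈B , refl ← ∈-map⁻ ℤ.+_ x∈
         with b , b∈B , refl ← ∈-map⁻ ℤ.+_ y∈
         = subst (_∈ signed) (sym (ℤ.m-n≡m⊖n a b)) (⊖∈signed a∈B b∈B)

progressionℕ : ℕ → List ℕ → List ℕ
progressionℕ a []       = a ∷ []
progressionℕ a (d ∷ ds) = a ∷ progressionℕ (a + d) ds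

progression-+ : ∀ a ds → progression (ℤ.+ a) (map ℤ.+_ ds) ≡ map ℤ.+_ (progressionℕ a ds)
progression-+ a []       = refl
progression-+ a (d ∷ ds) = cong (ℤ.+ a ∷_) (progression-+ (a + d) ds)

progression-≥ : ∀ {x} a ds → x ∈ progressionℕ a ds → a ≤ x
progression-≥ a []       (here refl) = ≤-refl
progression-≥ a (d ∷ ds) (here refl) = ≤-refl
progression-≥ a (d ∷ ds) (there x∈) = ≤-trans (m≤m+n a d) (progression-≥ (a + d) ds x∈)

progression-≤ : ∀ {x} a ds → x ∈ progressionℕ a ds → x ≤ a + sum ds
progression-≤ a []       (here refl) = ≤-reflexive (sym (+-identityʳ a))
progression-≤ a (d ∷ ds) (here refl) = m≤m+n a (d + sum ds)
progression-≤ a (d ∷ ds) (there x∈) =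
  ≤-trans (progression-≤ (a + d) ds x∈) (≤-reflexive (+-assoc a d (sum ds)))

a+d*0≡a : ∀ a d → a + d * 0 ≡ a
a+d*0≡a a d = trans (cong (a +_) (*-zeroʳ d)) (+-identityʳ a)

a+d+d*j≡a+d*[1+j] : ∀ a d j → (a + d) + d * j ≡ a + d * suc j
a+d+d*j≡a+d*[1+j] a d j = trans (+-assoc a d (d * j)) (cong (a +_) (sym (*-suc d j)))

∈-steps⁻ : ∀ {x} a d k ds → x ∈ progressionℕ a (replicate k d ++ ds) →
           (∃[ j ] j < k × x ≡ a + d * j) ⊎ x ∈ progressionℕ (a + d * k) ds
∈-steps⁻ {x} a d zero    ds x∈ = inj₂ (subst (λ b → x ∈ progressionℕ b ds) (sym (a+d*0≡a a d)) x∈)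
∈-steps⁻ a d (suc k) ds (here refl) = inj₁ (0 , z<s , sym (a+d*0≡a a d))
∈-steps⁻ {x} a d (suc k) ds (there x∈) with ∈-steps⁻ (a + d) d k ds x∈
... | inj₁ (j , j<k , refl) = inj₁ (suc j , s<s j<k , a+d+d*j≡a+d*[1+j] a d j)
... | inj₂ x∈rest           =
  inj₂ (subst (λ b → x ∈ progressionℕ b ds) (a+d+d*j≡a+d*[1+j] a d k) x∈rest)

∈-steps⁺ˡ : ∀ {j} a d k ds → j < k → a + d * j ∈ progressionℕ a (replicate k d ++ ds)
∈-steps⁺ˡ {zero}  a d (suc k) ds _ = here (a+d*0≡a a d)
∈-steps⁺ˡ {suc j} a d (suc k) ds (s<s j<k) =
  there (subst (_∈ progressionℕ (a + d) (replicate k d ++ ds)) (a+d+d*j≡a+d*[1+j] a d j)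
               (∈-steps⁺ˡ (a + d) d k ds j<k))

∈-steps⁺ʳ : ∀ {x} a d k ds → x ∈ progressionℕ (a + d * k) ds → x ∈ progressionℕ a (replicate k d ++ ds)
∈-steps⁺ʳ {x} a d zero    ds x∈ = subst (λ b → x ∈ progressionℕ b ds) (a+d*0≡a a d) x∈
∈-steps⁺ʳ {x} a d (suc k) ds x∈ =
  there (∈-steps⁺ʳ (a + d) d k ds (subst (λ b → x ∈ progressionℕ b ds) (sym (a+d+d*j≡a+d*[1+j] a d k)) x∈))

progressionℕ-shift : ∀ c a ds → progressionℕ (c + a) ds ≡ map (c +_) (progressionℕ a ds)
progressionℕ-shift c a []       = refl
progressionℕ-shift c a (d ∷ ds) =
  cong (c + a ∷_) (trans (cong (λ b → progressionℕ b ds) (+-assoc c a d)) (progressionℕ-shift c (a + d) ds))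

family : ℕ → List ℕ → List ℕ
family k rs = progressionℕ 1 (1 ∷ 1 ∷ 2 ∷ 1 ∷ replicate k 4 ++ rs)

family-≡ : ∀ k rs → progression (ℤ.+ 1) ((ℤ.+ 1 ∷ ℤ.+ 1 ∷ ℤ.+ 2 ∷ ℤ.+ 1 ∷ []) ++ fours k ++ map ℤ.+_ rs)
                    ≡ map ℤ.+_ (family k rs)
family-≡ k rs = trans (cong (λ gs → progression (ℤ.+ 1) (ℤ.+ 1 ∷ ℤ.+ 1 ∷ ℤ.+ 2 ∷ ℤ.+ 1 ∷ gs)) gaps)
                      (progression-+ 1 (1 ∷ 1 ∷ 2 ∷ 1 ∷ replicate k 4 ++ rs))
  where
  gaps : fours k ++ map ℤ.+_ rs ≡ map ℤ.+_ (replicate k 4 ++ rs)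
  gaps = sym (trans (map-++ ℤ.+_ (replicate k 4) rs) (cong (_++ map ℤ.+_ rs) (map-replicate ℤ.+_ k 4)))

lowPart : List ℕ
lowPart = 1 ∷ 2 ∷ 3 ∷ 5 ∷ []

data Member (k : ℕ) (T : List ℕ) : ℕ → Set where
  low : ∀ {l} → l ∈ lowPart → Member k T l
  mid : ∀ {j} → j ≤ k → Member k T (6 + 4 * j)
  top : ∀ {r} → r ∈ T → Member k T (6 + 4 * k + r)

member : ∀ {x} k d ds → x ∈ family k (d ∷ ds) → Member k (progressionℕ d ds) x
member k d ds (here refl)                         = low (here refl)
member k d ds (there (here refl))                 = low (there (here refl))
member k d ds (there (there (here refl)))         = low (there (there (here refl)))
member k d ds (there (there (there (here refl)))) = low (there (there (there (here refl))))
member k d ds (there (there (there (there x∈)))) with ∈-steps⁻ 6 4 k (d ∷ ds) x∈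
... | inj₁ (j , j<k , refl) = mid (<⇒≤ j<k)
... | inj₂ (here refl)      = mid ≤-refl
... | inj₂ (there x∈tail)
    with r , r∈T , refl ← ∈-map⁻ _ (subst (_ ∈_) (progressionℕ-shift (6 + 4 * k) d ds) x∈tail)
    = top r∈T

low∈ : ∀ {l} k rs → l ∈ lowPart → l ∈ family k rs
low∈ k rs (here refl)                         = here refl
low∈ k rs (there (here refl))                 = there (here refl)
low∈ k rs (there (there (here refl)))         = there (there (here refl))
low∈ k rs (there (there (there (here refl)))) = there (there (there (here refl)))

mid∈ : ∀ {j} k rs → j < k → 6 + 4 * j ∈ family k rs
mid∈ k rs j<k = there (there (there (there (∈-steps⁺ˡ 6 4 k rs j<k))))

offsets : List ℕ → List ℕ
offsets = progressionℕ 0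

apex∈ : ∀ {r} k d ds → r ∈ offsets (d ∷ ds) → 6 + 4 * k + r ∈ family k (d ∷ ds)
apex∈ k d ds (here refl) =
  there (there (there (there (∈-steps⁺ʳ 6 4 k (d ∷ ds) (here (+-identityʳ (6 + 4 * k)))))))
apex∈ k d ds (there r∈T) =
  there (there (there (there (∈-steps⁺ʳ 6 4 k (d ∷ ds)
    (there (subst (_ ∈_) (sym (progressionℕ-shift (6 + 4 * k) d ds)) (∈-map⁺ _ r∈T)))))))

Asc : ℕ → ℕ → List ℕ → Set
Asc lo hi []       = lo ≤ hi
Asc lo hi (x ∷ xs) = lo ≤ x × Asc (suc x) hi xs

asc? : ∀ lo hi xs → Dec (Asc lo hi xs)
asc? lo hi []       = lo ≤? hi
asc? lo hi (x ∷ xs) = (lo ≤? x) ×-dec asc? (suc x) hi xs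

Asc-lower : ∀ {a b c} xs → a ≤ b → Asc b c xs → Asc a c xs
Asc-lower []       a≤b b≤c         = ≤-trans a≤b b≤c
Asc-lower (x ∷ xs) a≤b (b≤x , asc) = ≤-trans a≤b b≤x , asc

Asc-++ : ∀ {a b c} xs {ys} → Asc a b xs → Asc b c ys → Asc a c (xs ++ ys)
Asc-++ []       a≤b         asc-ys = Asc-lower _ a≤b asc-ys
Asc-++ (x ∷ xs) (a≤x , asc) asc-ys = a≤x , Asc-++ xs asc asc-ys

Asc-shift : ∀ {a b} c xs → Asc a b xs → Asc (c + a) (c + b) (map (c +_) xs)
Asc-shift c []       a≤b         = +-monoʳ-≤ c a≤b
Asc-shift {b = b} c (x ∷ xs) (a≤x , asc) =
  +-monoʳ-≤ c a≤x , subst (λ lo → Asc lo (c + b) (map (c +_) xs)) (+-suc c x) (Asc-shift c xs asc)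

Asc-≤ : ∀ {a b} xs → Asc a b xs → All (a ≤_) xs
Asc-≤ []       _           = []
Asc-≤ (x ∷ xs) (a≤x , asc) = a≤x ∷ All.map (λ x<y → ≤-trans a≤x (<⇒≤ x<y)) (Asc-≤ xs asc)

Asc⇒Unique : ∀ {a b} xs → Asc a b xs → Unique xs
Asc⇒Unique []       _         = []
Asc⇒Unique (x ∷ xs) (_ , asc) =
  All.map (λ x<y x≡y → <-irrefl x≡y x<y) (Asc-≤ xs asc) ∷ Asc⇒Unique xs asc

Asc-upTo : ∀ n → Asc 0 n (upTo n)
Asc-upTo zero    = z≤n
Asc-upTo (suc n) = subst (Asc 0 (suc n)) (upTo-∷ʳ n) (Asc-++ (upTo n) (Asc-upTo n) (≤-refl , ≤-refl))

Asc-filter : ∀ {P : ℕ → Set} (P? : Decidable P) {a b} xs → Asc a b xs → Asc a b (filter P? xs)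
Asc-filter P? []       a≤b = a≤b
Asc-filter P? (x ∷ xs) (a≤x , asc) with does (P? x)
... | true  = a≤x , Asc-filter P? xs asc
... | false = Asc-lower (filter P? xs) (≤-trans a≤x (n≤1+n x)) (Asc-filter P? xs asc)

Asc-cast : ∀ {a a′ b b′} xs → a ≡ a′ → b ≡ b′ → Asc a b xs → Asc a′ b′ xs
Asc-cast xs refl refl asc = asc

-- blocks b k = b, b+1, b+2, b+4, b+5, b+6, …: k runs of three consecutive numbers, each run
-- followed by one omitted number.  The middle ranges of both B + B and B - B look like this.
blocks : ℕ → ℕ → List ℕ
blocks b zero    = []
blocks b (suc k) = b ∷ suc b ∷ suc (suc b) ∷ blocks (4 + b) k

length-blocks : ∀ b k → length (blocks b k) ≡ 3 * k
length-blocks b zero    = refl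
length-blocks b (suc k) = trans (cong (3 +_) (length-blocks (4 + b) k)) (sym (*-suc 3 k))

blocks-first : ∀ b ρ → b + 4 * 0 + ρ ≡ ρ + b
blocks-first = solve-∀

blocks-next : ∀ b i ρ → (4 + b) + 4 * i + ρ ≡ b + 4 * suc i + ρ
blocks-next = solve-∀

∈-blocks⁺ : ∀ b k {i ρ} → i < k → ρ < 3 → b + 4 * i + ρ ∈ blocks b k
∈-blocks⁺ b (suc k) {zero} {0} _ _ = here (blocks-first b 0)
∈-blocks⁺ b (suc k) {zero} {1} _ _ = there (here (blocks-first b 1))
∈-blocks⁺ b (suc k) {zero} {2} _ _ = there (there (here (blocks-first b 2)))
∈-blocks⁺ b (suc k) {zero} {suc (suc (suc ρ))} _ (s<s (s<s (s<s ())))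
∈-blocks⁺ b (suc k) {suc i} {ρ} (s<s i<k) ρ<3 =
  there (there (there (subst (_∈ blocks (4 + b) k) (blocks-next b i ρ) (∈-blocks⁺ (4 + b) k i<k ρ<3))))

∈-blocks⁻ : ∀ {x} b k → x ∈ blocks b k → ∃[ i ] ∃[ ρ ] i < k × ρ < 3 × x ≡ b + 4 * i + ρ
∈-blocks⁻ b (suc k) (here refl)                 = 0 , 0 , z<s , z<s , sym (blocks-first b 0)
∈-blocks⁻ b (suc k) (there (here refl))         = 0 , 1 , z<s , s<s z<s , sym (blocks-first b 1)
∈-blocks⁻ b (suc k) (there (there (here refl))) = 0 , 2 , z<s , s<s (s<s z<s) , sym (blocks-first b 2)
∈-blocks⁻ b (suc k) (there (there (there x∈))) with i , ρ , i<k , ρ<3 , refl ← ∈-blocks⁻ (4 + b) k x∈ =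
  suc i , ρ , s<s i<k , ρ<3 , blocks-next b i ρ

Asc-blocks : ∀ b k → Asc b (b + 4 * k) (blocks b k)
Asc-blocks b zero    = m≤m+n b 0
Asc-blocks b (suc k) =
  ≤-refl , ≤-refl , ≤-refl ,
  subst (λ hi → Asc (3 + b) hi (blocks (4 + b) k)) (blocks-end b k)
        (Asc-lower (blocks (4 + b) k) (n≤1+n (3 + b)) (Asc-blocks (4 + b) k))
  where
  blocks-end : ∀ b k → (4 + b) + 4 * k ≡ b + 4 * suc k
  blocks-end = solve-∀

NotTwoMod4 : ℕ → Set
NotTwoMod4 n = n % 4 ≢ 2

notTwoMod4? : ∀ n → Dec (NotTwoMod4 n)
notTwoMod4? n = ¬? (n % 4 ≟ 2)

-- posDiffs k h: the numbers 1, 2, …, 2 + 4k + h other than the k numbers 6, 10, …, 4k + 2.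
-- Together with 0 they will contain every non-negative difference of the family.
posDiffs : ℕ → ℕ → List ℕ
posDiffs k h = 1 ∷ 2 ∷ blocks 3 k ++ map ((3 + 4 * k) +_) (upTo h)

length-posDiffs : ∀ k h → length (posDiffs k h) ≡ 2 + (3 * k + h)
length-posDiffs k h = cong (2 +_) (trans (length-++ (blocks 3 k))
  (cong₂ _+_ (length-blocks 3 k) (trans (length-map _ (upTo h)) (length-upTo h))))

∈-high : ∀ k h {x} c → x ≡ 3 + 4 * k + c → c < h → x ∈ 0 ∷ posDiffs k h
∈-high k h c refl c<h = there (there (there (∈-++⁺ʳ (blocks 3 k) (∈-map⁺ _ (∈-upTo⁺ c<h)))))

-- Below the top range, only the numbers ≡ 2 (mod 4) are missing.
∈-run : ∀ k h {x} i {ρ} → ρ < 3 → x ≡ 3 + 4 * i + ρ → x < 3 + 4 * k + h → x ∈ 0 ∷ posDiffs k h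
∈-run k h {x} i {ρ} ρ<3 refl x<bound with i <? k
... | yes i<k = there (there (there (∈-++⁺ˡ (∈-blocks⁺ 3 k i<k ρ<3))))
... | no  i≮k = ∈-high k h (4 * (i ∸ k) + ρ) x≡ (+-cancelˡ-< (3 + 4 * k) _ _ (subst (_< 3 + 4 * k + h) x≡ x<bound))
  where
  regroup : ∀ k t ρ → 3 + 4 * (k + t) + ρ ≡ 3 + 4 * k + (4 * t + ρ)
  regroup = solve-∀
  x≡ : x ≡ 3 + 4 * k + (4 * (i ∸ k) + ρ)
  x≡ = trans (cong (λ i → 3 + 4 * i + ρ) (sym (m+[n∸m]≡n (≮⇒≥ i≮k)))) (regroup k (i ∸ k) ρ)

∈-residue : ∀ k h n {ρ} → ρ < 4 → ρ ≢ 2 → 4 * n + ρ < 3 + 4 * k + h → 4 * n + ρ ∈ 0 ∷ posDiffs k h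
∈-residue k h zero    {0} _ _ _ = here refl
∈-residue k h zero    {1} _ _ _ = there (here refl)
∈-residue k h (suc n) {0} _ _ x<bound = ∈-run k h n {1} (s<s z<s) (residue0 n) x<bound
  where
  residue0 : ∀ n → 4 * suc n + 0 ≡ 3 + 4 * n + 1
  residue0 = solve-∀
∈-residue k h (suc n) {1} _ _ x<bound = ∈-run k h n {2} (s<s (s<s z<s)) (residue1 n) x<bound
  where
  residue1 : ∀ n → 4 * suc n + 1 ≡ 3 + 4 * n + 2
  residue1 = solve-∀
∈-residue k h n       {2} _ ρ≢2 _ = contradiction refl ρ≢2
∈-residue k h n       {3} _ _ x<bound = ∈-run k h n {0} z<s (residue3 n) x<bound
  where
  residue3 : ∀ n → 4 * n + 3 ≡ 3 + 4 * n + 0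
  residue3 = solve-∀
∈-residue k h n {suc (suc (suc (suc ρ)))} (s<s (s<s (s<s (s<s ())))) _ _

∈-notTwoMod4 : ∀ k h n s → NotTwoMod4 s → 4 * n + s < 3 + 4 * k + h → 4 * n + s ∈ 0 ∷ posDiffs k h
∈-notTwoMod4 k h n s s≢2 x<bound =
  subst (_∈ 0 ∷ posDiffs k h) (sym x≡)
        (∈-residue k h (n + s / 4) (m%n<n s 4) s≢2 (subst (_< 3 + 4 * k + h) x≡ x<bound))
  where
  regroup : ∀ n ρ q → 4 * n + (ρ + q * 4) ≡ 4 * (n + q) + ρ
  regroup = solve-∀
  x≡ : 4 * n + s ≡ 4 * (n + s / 4) + s % 4
  x≡ = trans (cong (4 * n +_) (m≡m%n+[m/n]*n s 4)) (regroup n (s % 4) (s / 4))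

-- Admissible numbers (< 3 or ≢ 2 (mod 4)) lie in posDiffs below its bound; all differences
-- inside the block 1, 2, 3, 5 and inside the tail have to be admissible.
Admissible : ℕ → Set
Admissible n = n < 3 ⊎ NotTwoMod4 n

admissible? : ∀ n → Dec (Admissible n)
admissible? n = (n <? 3) ⊎-dec notTwoMod4? n

data DiffShape (k : ℕ) : ℕ → Set where
  small    : ∀ {d} → d < 3 → DiffShape k d
  periodic : ∀ n s → NotTwoMod4 s → DiffShape k (4 * n + s)
  high     : ∀ c → DiffShape k (3 + 4 * k + c)

shape∈ : ∀ k h {d} → DiffShape k d → d < 3 + 4 * k + h → d ∈ 0 ∷ posDiffs k h
shape∈ k h (small d<3)      _       = ∈-++⁺ˡ (∈-upTo⁺ d<3)
shape∈ k h (periodic n s s≢2) d<bound = ∈-notTwoMod4 k h n s s≢2 d<bound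
shape∈ k h (high c)         d<bound = ∈-high k h c refl (+-cancelˡ-< (3 + 4 * k) c h d<bound)

lowPart-bounds : All (λ l → 1 ≤ l × l ≤ 5) lowPart
lowPart-bounds = from-yes (all? (λ l → (1 ≤? l) ×-dec (l ≤? 5)) lowPart)

l≤5 : ∀ {l} → l ∈ lowPart → l ≤ 5
l≤5 l∈ = proj₂ (All.lookup lowPart-bounds l∈)

lowPart-diffs : All (λ l → All (λ l′ → Admissible (l ∸ l′)) lowPart) lowPart
lowPart-diffs = from-yes (all? (λ l → all? (λ l′ → admissible? (l ∸ l′)) lowPart) lowPart)

six∸lowPart : All (λ l → NotTwoMod4 (6 ∸ l)) lowPart
six∸lowPart = from-yes (all? (λ l → notTwoMod4? (6 ∸ l)) lowPart)

member-bounds : ∀ {k T R x} → (∀ {r} → r ∈ T → r ≤ R) → Member k T x → 1 ≤ x × x ≤ 6 + 4 * k + R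
member-bounds {k} {R = R} _ (low l∈) with 1≤l , l≤5 ← All.lookup lowPart-bounds l∈ =
  1≤l , ≤-trans l≤5 (≤-trans (n≤1+n 5) (≤-trans (m≤m+n 6 (4 * k)) (m≤m+n (6 + 4 * k) R)))
member-bounds {k} {R = R} _ (mid j≤k) =
  s≤s z≤n , ≤-trans (+-monoʳ-≤ 6 (*-monoʳ-≤ 4 j≤k)) (m≤m+n (6 + 4 * k) R)
member-bounds {k} T≤R (top r∈T) = s≤s z≤n , +-monoʳ-≤ (6 + 4 * k) (T≤R r∈T)

TailDiffsOK : List ℕ → Set
TailDiffsOK os = All (λ r → All (λ r′ → Admissible (r ∸ r′)) os) os

admissible-shape : ∀ k {s} → Admissible s → DiffShape k s
admissible-shape k (inj₁ s<3)  = small s<3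
admissible-shape k (inj₂ s≢2) = periodic 0 _ s≢2

mid∸low : ∀ j {l} → l ≤ 6 → 6 + 4 * j ∸ l ≡ 4 * j + (6 ∸ l)
mid∸low j {l} l≤6 = trans (cong (_∸ l) (+-comm 6 (4 * j))) (+-∸-assoc (4 * j) l≤6)

mid∸mid : ∀ j j′ → 6 + 4 * j ∸ (6 + 4 * j′) ≡ 4 * (j ∸ j′) + 0
mid∸mid j j′ = trans ([m+n]∸[m+o]≡n∸o 6 (4 * j) (4 * j′)) (trans (sym (*-distribˡ-∸ 4 j j′)) (sym (+-identityʳ _)))

top∸low : ∀ k r {l} → l ≤ 3 + r → 6 + 4 * k + r ∸ l ≡ 3 + 4 * k + (3 + r ∸ l)
top∸low k r {l} l≤3+r = trans (cong (_∸ l) (regroup k r)) (+-∸-assoc (3 + 4 * k) l≤3+r)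
  where
  regroup : ∀ k r → 6 + 4 * k + r ≡ 3 + 4 * k + (3 + r)
  regroup = solve-∀

top∸mid : ∀ k r {j} → j ≤ k → 6 + 4 * k + r ∸ (6 + 4 * j) ≡ 4 * (k ∸ j) + r
top∸mid k r {j} j≤k = begin
  6 + 4 * k + r ∸ (6 + 4 * j)   ≡⟨ cong (_∸ (6 + 4 * j)) (+-assoc 6 (4 * k) r) ⟩
  6 + (4 * k + r) ∸ (6 + 4 * j) ≡⟨ [m+n]∸[m+o]≡n∸o 6 (4 * k + r) (4 * j) ⟩
  4 * k + r ∸ 4 * j             ≡⟨ +-∸-comm r (*-monoʳ-≤ 4 j≤k) ⟩
  4 * k ∸ 4 * j + r             ≡⟨ cong (_+ r) (sym (*-distribˡ-∸ 4 k j)) ⟩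
  4 * (k ∸ j) + r               ∎
  where open ≡-Reasoning

-- Tail offsets are at least 3, so a tail
-- member exceeds every progression member and lies at least 3 above N.
diffShape : ∀ k {T a b} → (∀ {r} → r ∈ T → 3 ≤ r) → TailDiffsOK (0 ∷ T) →
            Member k T a → Member k T b → b ≤ a → DiffShape k (a ∸ b)
diffShape k _ _ (low l∈) (low l′∈) _ = admissible-shape k (All.lookup (All.lookup lowPart-diffs l∈) l′∈)
diffShape k _ _ (low l∈) (mid _) b≤a = contradiction (≤-trans b≤a (l≤5 l∈)) (<⇒≱ (m≤m+n 6 _))
diffShape k _ _ (low l∈) (top _) b≤a = contradiction (≤-trans b≤a (l≤5 l∈)) (<⇒≱ (m≤m+n 6 _))
diffShape k _ _ (mid {j} _) (low {l} l∈) _ =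
  subst (DiffShape k) (sym (mid∸low j (≤-trans (l≤5 l∈) (n≤1+n 5))))
        (periodic j (6 ∸ l) (All.lookup six∸lowPart l∈))
diffShape k _ _ (mid {j} _) (mid {j′} _) _ = subst (DiffShape k) (sym (mid∸mid j j′)) (periodic (j ∸ j′) 0 λ ())
diffShape k T≥3 _ (mid j≤k) (top r∈T) b≤a =
  contradiction (≤-trans b≤a (+-monoʳ-≤ 6 (*-monoʳ-≤ 4 j≤k)))
                (<⇒≱ (m<m+n (6 + 4 * k) (≤-trans (s≤s z≤n) (T≥3 r∈T))))
diffShape k T≥3 _ (top {r} r∈T) (low {l} l∈) _ =
  subst (DiffShape k) (sym (top∸low k r (≤-trans (l≤5 l∈) (+-monoʳ-≤ 3 (≤-trans (n≤1+n 2) (T≥3 r∈T))))))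
        (high (3 + r ∸ l))
diffShape k T≥3 ok (top {r} r∈T) (mid {j} j≤k) _ with All.lookup (All.lookup ok (there r∈T)) (here refl)
... | inj₁ r<3  = contradiction (T≥3 r∈T) (<⇒≱ r<3)
... | inj₂ r≢2 = subst (DiffShape k) (sym (top∸mid k r j≤k)) (periodic (k ∸ j) r r≢2)
diffShape k _ ok (top {r} r∈T) (top {r′} r′∈T) _ =
  subst (DiffShape k) (sym ([m+n]∸[m+o]≡n∸o (6 + 4 * k) r r′))
        (admissible-shape k (All.lookup (All.lookup ok (there r∈T)) (there r′∈T)))

family-diffs : ∀ k d ds → 3 ≤ d → TailDiffsOK (offsets (d ∷ ds)) →
               card (diffset (map ℤ.+_ (family k (d ∷ ds)))) ≤ 11 + 6 * k + 2 * (d + sum ds)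
family-diffs k d ds 3≤d ok =
  subst (card (diffset (map ℤ.+_ (family k (d ∷ ds)))) ≤_) size
        (diffset-≤ (family k (d ∷ ds)) (posDiffs k (R + 3)) diff∈)
  where
  R = d + sum ds
  T = progressionℕ d ds

  T≥3 : ∀ {r} → r ∈ T → 3 ≤ r
  T≥3 r∈T = ≤-trans 3≤d (progression-≥ d ds r∈T)

  size : suc (length (posDiffs k (R + 3)) + length (posDiffs k (R + 3))) ≡ 11 + 6 * k + 2 * R
  size = trans (cong (λ n → suc (n + n)) (length-posDiffs k (R + 3))) (count k R)
    where
    count : ∀ k R → suc (2 + (3 * k + (R + 3)) + (2 + (3 * k + (R + 3)))) ≡ 11 + 6 * k + 2 * R
    count = solve-∀

  diff-bound : ∀ {a b} → Member k T a → Member k T b → b ≤ a → a ∸ b < 3 + 4 * k + (R + 3)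
  diff-bound ma mb b≤a with _ , a≤max ← member-bounds (progression-≤ d ds) ma
                   with 1≤b , _ ← member-bounds (progression-≤ d ds) mb
    = <-≤-trans (∸-monoʳ-< 1≤b b≤a) (≤-trans a≤max (≤-reflexive (regroup k R)))
    where
    regroup : ∀ k R → 6 + 4 * k + R ≡ 3 + 4 * k + (R + 3)
    regroup = solve-∀

  diff∈ : ∀ {a b} → a ∈ family k (d ∷ ds) → b ∈ family k (d ∷ ds) → b ≤ a → a ∸ b ∈ 0 ∷ posDiffs k (R + 3)
  diff∈ a∈ b∈ b≤a with ma ← member k d ds a∈ | mb ← member k d ds b∈ =
    shape∈ k (R + 3) (diffShape k T≥3 ok ma mb b≤a) (diff-bound ma mb b≤a)

-- The five smallest members of the family (6 = 6 + 4·0 is a member once k ≥ 1).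
firstFive : List ℕ
firstFive = 1 ∷ 2 ∷ 3 ∷ 5 ∷ 6 ∷ []

firstFive⊆ : ∀ ℓ rs → firstFive ⊆ family (suc ℓ) rs
firstFive⊆ ℓ rs (here refl)                                 = low∈ (suc ℓ) rs (here refl)
firstFive⊆ ℓ rs (there (here refl))                         = low∈ (suc ℓ) rs (there (here refl))
firstFive⊆ ℓ rs (there (there (here refl)))                 = low∈ (suc ℓ) rs (there (there (here refl)))
firstFive⊆ ℓ rs (there (there (there (here refl))))         = low∈ (suc ℓ) rs (there (there (there (here refl))))
firstFive⊆ ℓ rs (there (there (there (there (here refl))))) = mid∈ (suc ℓ) rs z<s

lowSums : List ℕ
lowSums = 2 ∷ 3 ∷ 4 ∷ 5 ∷ 6 ∷ 7 ∷ 8 ∷ 9 ∷ 10 ∷ []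

lowSums⊆ : All (_∈ sumsℕ firstFive) lowSums
lowSums⊆ = from-yes (all? (_∈? sumsℕ firstFive) lowSums)

midSum? : ∀ os → Decidable (λ c → 1 + c ∈ cartesianProductWith _+_ os firstFive)
midSum? os c = 1 + c ∈? cartesianProductWith _+_ os firstFive

midOffsets : List ℕ → List ℕ
midOffsets os = filter (midSum? os) (upTo 12)

topSum? : ∀ os → Decidable (λ c → 3 + c ∈ sumsℕ os)
topSum? os c = 3 + c ∈? sumsℕ os

topOffsets : List ℕ → ℕ → List ℕ
topOffsets os H = filter (topSum? os) (upTo H)

apex : ℕ → ℕ
apex k = 6 + 4 * k

-- An increasing list of sums of the family with k = ℓ + 1 and N = apex k: the sums 2, …, 10,
-- the blocks 11, 12, 13, 15, … up to N + 1 (missing 14, 18, …, N), the sums N + 1 + c for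
-- c ∈ midOffsets, the blocks from N + 13 up to 2N + 3, and the sums 2N + 3 + c for c ∈ topOffsets.
sumWitness : ℕ → List ℕ → ℕ → List ℕ
sumWitness ℓ os H =
  lowSums ++ blocks 11 ℓ ++ map ((apex (suc ℓ) + 1) +_) (midOffsets os) ++
  blocks (apex (suc ℓ) + 13) ℓ ++ map ((apex (suc ℓ) + apex (suc ℓ) + 3) +_) (topOffsets os H)

length-sumWitness : ∀ ℓ os H →
  length (sumWitness ℓ os H) ≡ 9 + 6 * ℓ + (length (midOffsets os) + length (topOffsets os H))
length-sumWitness ℓ os H =
  trans (length-++ lowSums {blocks 11 ℓ ++ mid-part ++ blocks (N + 13) ℓ ++ top-part})
  (trans (cong (9 +_)
    (trans (length-++ (blocks 11 ℓ) {mid-part ++ blocks (N + 13) ℓ ++ top-part})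
     (cong₂ _+_ (length-blocks 11 ℓ)
      (trans (length-++ mid-part {blocks (N + 13) ℓ ++ top-part})
       (cong₂ _+_ (length-map _ mids)
        (trans (length-++ (blocks (N + 13) ℓ) {top-part})
         (cong₂ _+_ (length-blocks (N + 13) ℓ) (length-map _ tops))))))))
  (regroup ℓ (length mids) (length tops)))
  where
  N = apex (suc ℓ)
  mids = midOffsets os
  tops = topOffsets os H
  mid-part = map ((N + 1) +_) mids
  top-part = map ((N + N + 3) +_) tops
  regroup : ∀ ℓ m t → 9 + (3 * ℓ + (m + (3 * ℓ + t))) ≡ 9 + 6 * ℓ + (m + t)
  regroup = solve-∀

Asc-sumWitness : ∀ ℓ os H → Asc 2 (apex (suc ℓ) + apex (suc ℓ) + 3 + H) (sumWitness ℓ os H)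
Asc-sumWitness ℓ os H =
  Asc-++ lowSums (from-yes (asc? 2 11 lowSums))
  (Asc-++ (blocks 11 ℓ) (Asc-cast (blocks 11 ℓ) refl (end₁ ℓ) (Asc-blocks 11 ℓ))
  (Asc-++ (map ((N + 1) +_) mids)
          (Asc-cast _ (+-identityʳ (N + 1)) (+-assoc N 1 12)
             (Asc-shift (N + 1) mids (Asc-filter (midSum? os) (upTo 12) (Asc-upTo 12))))
  (Asc-++ (blocks (N + 13) ℓ) (Asc-cast (blocks (N + 13) ℓ) refl (end₂ ℓ) (Asc-blocks (N + 13) ℓ))
          (Asc-cast _ (+-identityʳ (N + N + 3)) refl
             (Asc-shift (N + N + 3) tops (Asc-filter (topSum? os) (upTo H) (Asc-upTo H)))))))
  where
  N = apex (suc ℓ)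
  mids = midOffsets os
  tops = topOffsets os H
  end₁ : ∀ ℓ → 11 + 4 * ℓ ≡ 6 + 4 * suc ℓ + 1
  end₁ = solve-∀
  end₂ : ∀ ℓ → 6 + 4 * suc ℓ + 13 + 4 * ℓ ≡ 6 + 4 * suc ℓ + (6 + 4 * suc ℓ) + 3
  end₂ = solve-∀

++-⊆ : ∀ {A : Set} {xs ys zs : List A} → xs ⊆ zs → ys ⊆ zs → xs ++ ys ⊆ zs
++-⊆ {xs = xs} xs⊆zs ys⊆zs v∈ = [ xs⊆zs , ys⊆zs ]′ (∈-++⁻ xs v∈)

1+ρ∈lowPart : ∀ {ρ} → ρ < 3 → 1 + ρ ∈ lowPart
1+ρ∈lowPart {0} _ = here refl
1+ρ∈lowPart {1} _ = there (here refl)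
1+ρ∈lowPart {2} _ = there (there (here refl))
1+ρ∈lowPart {suc (suc (suc _))} (s<s (s<s (s<s ())))

3+ρ∈3-4-5 : ∀ {ρ} → ρ < 3 → 3 + ρ ∈ 3 ∷ 4 ∷ 5 ∷ []
3+ρ∈3-4-5 {0} _ = here refl
3+ρ∈3-4-5 {1} _ = there (here refl)
3+ρ∈3-4-5 {2} _ = there (there (here refl))
3+ρ∈3-4-5 {suc (suc (suc _))} (s<s (s<s (s<s ())))

sumWitness⊆ : ∀ ℓ d ds H → All (_∈ offsets (d ∷ ds)) (3 ∷ 4 ∷ 5 ∷ []) →
              sumWitness ℓ (offsets (d ∷ ds)) H ⊆ sumsℕ (family (suc ℓ) (d ∷ ds))
sumWitness⊆ ℓ d ds H 3-4-5∈os =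
  ++-⊆ (λ y∈ → sumsℕ-mono (firstFive⊆ ℓ rs) (All.lookup lowSums⊆ y∈))
  (++-⊆ lowerBlock (++-⊆ middle (++-⊆ upperBlock highest)))
  where
  rs = d ∷ ds
  os = offsets rs
  N = apex (suc ℓ)
  B = family (suc ℓ) rs

  lowerBlock : blocks 11 ℓ ⊆ sumsℕ B
  lowerBlock y∈ with i , ρ , i<ℓ , ρ<3 , refl ← ∈-blocks⁻ 11 ℓ y∈ =
    sum∈ (mid∈ (suc ℓ) rs (s<s i<ℓ)) (low∈ (suc ℓ) rs (1+ρ∈lowPart ρ<3)) (regroup i ρ)
    where
    regroup : ∀ i ρ → 6 + 4 * suc i + (1 + ρ) ≡ 11 + 4 * i + ρ
    regroup = solve-∀

  -- N + 1 + c = (N + r) + l with r ∈ os and l ∈ firstFive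
  middle : map ((N + 1) +_) (midOffsets os) ⊆ sumsℕ B
  middle y∈ with c , c∈ , refl ← ∈-map⁻ _ y∈
            with _ , 1+c∈ ← ∈-filter⁻ (midSum? os) {xs = upTo 12} c∈
            with r , l , r∈ , l∈ , 1+c≡r+l ← ∈-cartesianProductWith⁻ _+_ os firstFive 1+c∈ =
    sum∈ (apex∈ (suc ℓ) d ds r∈) (firstFive⊆ ℓ rs l∈)
         (trans (+-assoc N r l) (trans (cong (N +_) (sym 1+c≡r+l)) (sym (+-assoc N 1 c))))

  upperBlock : blocks (N + 13) ℓ ⊆ sumsℕ B
  upperBlock y∈ with i , ρ , i<ℓ , ρ<3 , refl ← ∈-blocks⁻ (N + 13) ℓ y∈ =
    sum∈ (apex∈ (suc ℓ) d ds (All.lookup 3-4-5∈os (3+ρ∈3-4-5 ρ<3))) (mid∈ (suc ℓ) rs (s<s i<ℓ))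
         (regroup N i ρ)
    where
    regroup : ∀ N i ρ → N + (3 + ρ) + (6 + 4 * suc i) ≡ N + 13 + 4 * i + ρ
    regroup = solve-∀

  -- 2N + 3 + c = (N + r) + (N + r′) with r, r′ ∈ os
  highest : map ((N + N + 3) +_) (topOffsets os H) ⊆ sumsℕ B
  highest y∈ with c , c∈ , refl ← ∈-map⁻ _ y∈
             with _ , 3+c∈ ← ∈-filter⁻ (topSum? os) {xs = upTo H} c∈
             with r , r′ , r∈ , r′∈ , 3+c≡r+r′ ← ∈-cartesianProductWith⁻ _+_ os os 3+c∈ =
    sum∈ (apex∈ (suc ℓ) d ds r∈) (apex∈ (suc ℓ) d ds r′∈)
         (trans (regroup N r r′) (trans (cong (N + N +_) (sym 3+c≡r+r′)) (sym (+-assoc (N + N) 3 c))))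
    where
    regroup : ∀ N r r′ → N + r + (N + r′) ≡ N + N + (r + r′)
    regroup = solve-∀

GoodTail : ℕ → List ℕ → Set
GoodTail d ds =
  3 ≤ d × TailDiffsOK os × All (_∈ os) (3 ∷ 4 ∷ 5 ∷ []) ×
  2 * R + 8 < length (midOffsets os) + length (topOffsets os (2 * R))
  where
  os = offsets (d ∷ ds)
  R = d + sum ds

goodTail? : ∀ d ds → Dec (GoodTail d ds)
goodTail? d ds =
  (3 ≤? d) ×-dec all? (λ r → all? (λ r′ → admissible? (r ∸ r′)) os) os ×-dec
  all? (_∈? os) (3 ∷ 4 ∷ 5 ∷ []) ×-dec
  (2 * R + 8 <? length (midOffsets os) + length (topOffsets os (2 * R)))
  where
  os = offsets (d ∷ ds)
  R = d + sum ds

family-mstd : ∀ ℓ d ds → GoodTail d ds → MSTD (map ℤ.+_ (family (suc ℓ) (d ∷ ds)))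
family-mstd ℓ d ds (3≤d , ok , 3-4-5∈os , enough) = begin-strict
  card (diffset (map ℤ.+_ B))    ≤⟨ family-diffs (suc ℓ) d ds 3≤d ok ⟩
  11 + 6 * suc ℓ + 2 * R         ≡⟨ regroup ℓ R ⟩
  9 + 6 * ℓ + (2 * R + 8)        <⟨ +-monoʳ-< (9 + 6 * ℓ) enough ⟩
  9 + 6 * ℓ + (length (midOffsets os) + length (topOffsets os H))
                                 ≡⟨ sym (length-sumWitness ℓ os H) ⟩
  length (sumWitness ℓ os H)     ≤⟨ sumset-≥ B (sumWitness ℓ os H) (Asc⇒Unique _ (Asc-sumWitness ℓ os H))
                                             (sumWitness⊆ ℓ d ds H 3-4-5∈os) ⟩
  card (sumset (map ℤ.+_ B))     ∎
  where
  open ≤-Reasoning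
  B = family (suc ℓ) (d ∷ ds)
  os = offsets (d ∷ ds)
  R = d + sum ds
  H = 2 * R
  regroup : ∀ ℓ R → 11 + 6 * suc ℓ + 2 * R ≡ 9 + 6 * ℓ + (2 * R + 8)
  regroup = solve-∀

-- Each Aᵢ (m) has gaps 1, 1, 2, 1, then m gaps 4, then the tail 3 ∷ dsᵢ; the three tails
-- satisfy the criterion, which is checked by evaluation.
lemma3p4 : (m : ℕ) → 1 ≤ m → MSTD (A₁ m) × MSTD (A₂ m) × MSTD (A₃ m)
lemma3p4 (suc ℓ) _ =
  mstd (1 ∷ 1 ∷ 2 ∷ [])     (from-yes (goodTail? 3 (1 ∷ 1 ∷ 2 ∷ []))) ,
  mstd (1 ∷ 1 ∷ 2 ∷ 1 ∷ []) (from-yes (goodTail? 3 (1 ∷ 1 ∷ 2 ∷ 1 ∷ []))) ,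
  mstd (1 ∷ 1 ∷ [])         (from-yes (goodTail? 3 (1 ∷ 1 ∷ [])))
  where
  mstd : ∀ ds → GoodTail 3 ds →
         MSTD (progression (ℤ.+ 1)
                 ((ℤ.+ 1 ∷ ℤ.+ 1 ∷ ℤ.+ 2 ∷ ℤ.+ 1 ∷ []) ++ fours (suc ℓ) ++ map ℤ.+_ (3 ∷ ds)))
  mstd ds good = subst MSTD (sym (family-≡ (suc ℓ) (3 ∷ ds))) (family-mstd ℓ 3 ds good)
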